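{- Let $D$ be a diagnoser for a partially observable plant $P$ with alarm $A$, let $\beta$ be a diagnosis condition and $d\ge 0$. Then for every trace $\sigma$ of $D\otimes P$: $\sigma\models G\big((\beta\to X^d[KY^d\beta]_o)\to(\beta\to X^d[A]_o)\big)$ if and only if $\sigma\models G([KY^d\beta]_o\to[A]_o)$.
   Context: An LTS is $S=\langle V,E,I,\mathcal T\rangle$ (finite set $V$ of variables over a finite domain, events $E$, initial formula $I$, transition formulas $\mathcal T(e)$ over $V\cup V'$). A trace is an infinite sequence $\sigma=s_0,e_0,s_1,e_1,\dots$ with $s_0\models I$ and $\langle s_k,s_{k+1}\rangle\models\mathcal T(e_k)$ (deadlock freedom assumed); $\sigma^k=s_0,e_0,\dots,s_k$. A plant $P=\langle V^P,E^P,I^P,\mathcal T^P,E^P_o\rangle$ has observable events $E^P_o\subseteq E^P$. $\mathit{obs}(\sigma^k)$ = subsequence of observable events among $e_0,\dots,e_{k-1}$; $\mathit{ObsPoint}(\sigma,i)$ iff $i>0$ and $e_{i-1}\in E_o$; $((\sigma_1,i),(\sigma_2,j))\in\mathit{ObsEq}$ iff ($\mathit{ObsPoint}(\sigma_1,i)\Leftrightarrow\mathit{ObsPoint}(\sigma_2,j)$) and $\mathit{obs}(\sigma_1^i)=\mathit{obs}(\sigma_2^j)$. A diagnoser for $P$ is a deterministic LTS $D$ (one initial state, one successor per event from each reachable state) with event set $E^P_o$, variables disjoint from $V^P$, containing Boolean alarm variables. $D\otimes P$ is the asynchronous product (on unobservable plant events $D$'s variables are unchanged, on observable events both move), regarded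 as partially observable with observable events $E^P_o$. Logic: LTL with past, reflexive semantics ($Y\beta$ at $i$ iff $i>0$ and $\beta$ at $i-1$; $O$, $G$ include the current position; $X$ next; $Y^n,X^n$ iterates; $\sigma,i\models e$ iff $e_i=e$), extended with $K$: $\sigma_1,i\models K\beta$ iff for every trace $\sigma_2$ of $D\otimes P$ and every $j$ with $((\sigma_1,i),(\sigma_2,j))\in\mathit{ObsEq}$, $\sigma_2,j\models\beta$. $[\phi]_o$ abbreviates $\phi\wedge Y\bigvee_{e\in E_o}e$. $\sigma\models\psi$ means $\sigma,0\models\psi$. A diagnosis condition is a formula over plant propositions built with $\wedge,\neg,O,Y$. -}

module Defs where

open import Data.Nat using (ℕ; zero; suc; _≤_)
open import Data.Fin using (Fin)
open import Data.Bool using (Bool; true; false; T; if_then_else_)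
open import Data.List using (List; []; _∷_; _++_)
open import Data.Product using (Σ; ∃-syntax; _×_; _,_)
open import Data.Empty using (⊥)
open import Relation.Nullary using (¬_)
open import Relation.Binary.PropositionalEquality using (_≡_; subst)
open import Function.Bundles using (_↔_)
open import Function using (id)

Finite : Set → Set
Finite A = Σ ℕ (λ n → A ↔ Fin n)

-- The initial formula and the
-- transition formulas are represented semantically (as predicates on
-- states / pairs of states).

record LTSCore (E : Set) : Set₁ where
  field
    Var   : Set
    Dom   : Var → Set
    Init  : ((v : Var) → Dom v) → Set
    Trans : E → ((v : Var) → Dom v) → ((v : Var) → Dom v) → Set

  State : Set
  State = (v : Var) → Dom v

  _≐_ : State → State → Set
  s ≐ t = ∀ v → s v ≡ t v

module _ {E : Set} (L : LTSCore E) where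
  open LTSCore L
  data Reachable : State → Set where
    init : ∀ {s} → Init s → Reachable s
    step : ∀ {s s' e} → Reachable s → Trans e s s' → Reachable s'

record LTS (E : Set) : Set₁ where
  field
    core          : LTSCore E
    var-finite    : Finite (LTSCore.Var core)
    dom-finite    : ∀ v → Finite (LTSCore.Dom core v)
    deadlock-free : ∀ s → Reachable core s →
                    ∃[ e ] ∃[ s' ] LTSCore.Trans core e s s'

-- Partially observable plants: E^P_o given by a Boolean characteristic
-- function isObs.

record Plant : Set₁ where
  field
    Event : Set
    lts   : LTS Event
    isObs : Event → Bool

  open LTSCore (LTS.core lts) public

  ObsEvent : Set
  ObsEvent = Σ Event (λ e → T (isObs e))

-- Disjointness of the
-- variables from V^P is structural: the product state is a pair.

record Diagnoser (P : Plant) : Set₁ where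
  field
    lts : LTS (Plant.ObsEvent P)

  open LTSCore (LTS.core lts) public

  field
    isAlarm       : Var → Set
    alarm-bool    : ∀ v → isAlarm v → Dom v ≡ Bool
    init-unique   : Σ State (λ s₀ → Init s₀ × (∀ s → Init s → s ≐ s₀))
    deterministic : ∀ s → Reachable (LTS.core lts) s → ∀ e →
                    Σ State (λ s' → Trans e s s' × (∀ s'' → Trans e s s'' → s'' ≐ s'))

data DiagCond (P : Plant) : Set where
  var≡ : (v : Plant.Var P) → Plant.Dom P v → DiagCond P
  event : Plant.Event P → DiagCond P
  _∧c_ : DiagCond P → DiagCond P → DiagCond P
  ¬c   : DiagCond P → DiagCond P
  Oc   : DiagCond P → DiagCond P
  Yc   : DiagCond P → DiagCond P


module Sem (P : Plant) (D : Diagnoser P) where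
  private
    module P = Plant P
    module D = Diagnoser D

  -- a (candidate) infinite run  s₀, e₀, s₁, e₁, …  of D ⊗ P
  record PTrace : Set where
    field
      dst : ℕ → D.State
      pst : ℕ → P.State
      ev  : ℕ → P.Event
  open PTrace public

  DStep : P.Event → D.State → D.State → Set
  DStep e d d' = ((o : T (P.isObs e)) → D.Trans (e , o) d d')
               × (¬ T (P.isObs e) → d' D.≐ d)

  IsTrace : PTrace → Set
  IsTrace σ = D.Init (dst σ 0) × P.Init (pst σ 0)
            × (∀ k → P.Trans (ev σ k) (pst σ k) (pst σ (suc k))
                   × DStep (ev σ k) (dst σ k) (dst σ (suc k)))

  obs : PTrace → ℕ → List P.Event
  obs σ zero    = []
  obs σ (suc k) = obs σ k ++ (if P.isObs (ev σ k) then ev σ k ∷ [] else [])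

  ObsPoint : PTrace → ℕ → Set
  ObsPoint σ zero    = ⊥
  ObsPoint σ (suc i) = T (P.isObs (ev σ i))

  ObsEq : PTrace → ℕ → PTrace → ℕ → Set
  ObsEq σ₁ i σ₂ j = ((ObsPoint σ₁ i → ObsPoint σ₂ j) × (ObsPoint σ₂ j → ObsPoint σ₁ i))
                  × obs σ₁ i ≡ obs σ₂ j

  Fm : Set₁
  Fm = PTrace → ℕ → Set

  _⇒_ : Fm → Fm → Fm
  (φ ⇒ ψ) σ i = φ σ i → ψ σ i

  _∧f_ : Fm → Fm → Fm
  (φ ∧f ψ) σ i = φ σ i × ψ σ i

  ¬f : Fm → Fm
  ¬f φ σ i = ¬ φ σ i

  Yf : Fm → Fm
  Yf φ σ zero    = ⊥
  Yf φ σ (suc i) = φ σ i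

  Xf : Fm → Fm
  Xf φ σ i = φ σ (suc i)

  Of : Fm → Fm
  Of φ σ i = Σ ℕ (λ j → j ≤ i × φ σ j)

  Gf : Fm → Fm
  Gf φ σ i = ∀ j → i ≤ j → φ σ j

  Yⁿ : ℕ → Fm → Fm
  Yⁿ zero    φ = φ
  Yⁿ (suc n) φ = Yf (Yⁿ n φ)

  Xⁿ : ℕ → Fm → Fm
  Xⁿ zero    φ = φ
  Xⁿ (suc n) φ = Xf (Xⁿ n φ)

  ObsEv : Fm
  ObsEv σ i = T (P.isObs (ev σ i))

  [_]o : Fm → Fm
  [ φ ]o = φ ∧f Yf ObsEv

  Kf : Fm → Fm
  Kf φ σ₁ i = ∀ (σ₂ : PTrace) → IsTrace σ₂ → ∀ j → ObsEq σ₁ i σ₂ j → φ σ₂ j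

  AlarmF : (A : D.Var) → D.isAlarm A → Fm
  AlarmF A a σ i = T (subst id (D.alarm-bool A a) (dst σ i A))

  _⊨_ : PTrace → Fm → Set
  σ ⊨ φ = φ σ 0

  ⟦_⟧ : DiagCond P → Fm
  ⟦ var≡ v c ⟧ σ i = pst σ i v ≡ c
  ⟦ event e ⟧  σ i = ev σ i ≡ e
  ⟦ β ∧c γ ⟧      = ⟦ β ⟧ ∧f ⟦ γ ⟧
  ⟦ ¬c β ⟧        = ¬f ⟦ β ⟧
  ⟦ Oc β ⟧        = Of ⟦ β ⟧
  ⟦ Yc β ⟧        = Yf ⟦ β ⟧

-- Knowledge is factive: σ is itself a trace observationally equivalent to σ
-- at i, so Kφ at i yields φ at i.  Hence [K Yᵈ β]ₒ at j forces β at j ∸ d,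
-- and there the premise β → Xᵈ [K Yᵈ β]ₒ holds outright, so the left-hand
-- side delivers the alarm at j.  Conversely, the right-hand side applied at
-- position i + d turns Xᵈ [K Yᵈ β]ₒ at i into Xᵈ [A]ₒ at i.
module Submission where

open import Defs
open import Data.Nat using (ℕ; zero; suc; _+_; z≤n)
open import Data.Nat.Properties using (+-identityʳ; +-suc)
open import Data.Product using (Σ; _×_; _,_; proj₁)
open import Function using (id)
open import Relation.Binary.PropositionalEquality using (_≡_; refl; sym; trans; cong; subst)

module _ {P : Plant} {D : Diagnoser P} where
  open Sem P D

  Xⁿ-≡-shift : ∀ n (φ : Fm) σ i → Xⁿ n φ σ i ≡ φ σ (i + n)
  Xⁿ-≡-shift zero    φ σ i = cong (φ σ) (sym (+-identityʳ i))
  Xⁿ-≡-shift (suc n) φ σ i = trans (Xⁿ-≡-shift n φ σ (suc i)) (cong (φ σ) (sym (+-suc i n)))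

  Xⁿ-elim : ∀ n (φ : Fm) σ i → Xⁿ n φ σ i → φ σ (i + n)
  Xⁿ-elim n φ σ i = subst id (Xⁿ-≡-shift n φ σ i)

  Xⁿ-intro : ∀ n (φ : Fm) σ i → φ σ (i + n) → Xⁿ n φ σ i
  Xⁿ-intro n φ σ i = subst id (sym (Xⁿ-≡-shift n φ σ i))

  Yⁿ-elim : ∀ n (φ : Fm) σ j → Yⁿ n φ σ j → Σ ℕ (λ i → i + n ≡ j × φ σ i)
  Yⁿ-elim zero    φ σ j       φj = j , +-identityʳ j , φj
  Yⁿ-elim (suc n) φ σ (suc j) Yφ with Yⁿ-elim n φ σ j Yφ
  ... | i , i+n≡j , φi = i , trans (+-suc i n) (cong suc i+n≡j) , φi

  ObsEq-refl : ∀ σ i → ObsEq σ i σ i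
  ObsEq-refl σ i = (id , id) , refl

  K-factive : ∀ (φ : Fm) σ → IsTrace σ → ∀ i → Kf φ σ i → φ σ i
  K-factive φ σ tr i Kφ = Kφ σ tr i (ObsEq-refl σ i)

theorem4p5 : (P : Plant) (D : Diagnoser P) (A : Diagnoser.Var D) (a : Diagnoser.isAlarm D A)
             (β : DiagCond P) (d : ℕ) (σ : Sem.PTrace P D) → Sem.IsTrace P D σ →
             let open Sem P D in
             ((σ ⊨ Gf ((⟦ β ⟧ ⇒ Xⁿ d [ Kf (Yⁿ d ⟦ β ⟧) ]o) ⇒ (⟦ β ⟧ ⇒ Xⁿ d [ AlarmF A a ]o)))
               → (σ ⊨ Gf ([ Kf (Yⁿ d ⟦ β ⟧) ]o ⇒ [ AlarmF A a ]o)))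
             × ((σ ⊨ Gf ([ Kf (Yⁿ d ⟦ β ⟧) ]o ⇒ [ AlarmF A a ]o))
               → (σ ⊨ Gf ((⟦ β ⟧ ⇒ Xⁿ d [ Kf (Yⁿ d ⟦ β ⟧) ]o) ⇒ (⟦ β ⟧ ⇒ Xⁿ d [ AlarmF A a ]o))))
theorem4p5 P D A a β d σ tr = delayed⇒direct , direct⇒delayed
  where
  open Sem P D
  known : Fm
  known = [ Kf (Yⁿ d ⟦ β ⟧) ]o
  alarm : Fm
  alarm = [ AlarmF A a ]o

  delayed⇒direct : σ ⊨ Gf ((⟦ β ⟧ ⇒ Xⁿ d known) ⇒ (⟦ β ⟧ ⇒ Xⁿ d alarm)) → σ ⊨ Gf (known ⇒ alarm)
  delayed⇒direct g j _ knownʲ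
    with Yⁿ-elim d ⟦ β ⟧ σ j (K-factive (Yⁿ d ⟦ β ⟧) σ tr j (proj₁ knownʲ))
  ... | i , refl , βⁱ =
    Xⁿ-elim d alarm σ i (g i z≤n (λ _ → Xⁿ-intro d known σ i knownʲ) βⁱ)

  direct⇒delayed : σ ⊨ Gf (known ⇒ alarm) → σ ⊨ Gf ((⟦ β ⟧ ⇒ Xⁿ d known) ⇒ (⟦ β ⟧ ⇒ Xⁿ d alarm))
  direct⇒delayed g i _ β⇒known βⁱ =
    Xⁿ-intro d alarm σ i (g (i + d) z≤n (Xⁿ-elim d known σ i (β⇒known βⁱ)))
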